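{- Let $n\ge4$ and let $\Delta_n$ be a uniform flag complex on the vertex set $V_n$ representing a triangulation of $\partial P_n$. Assume that pairs of arrows of types $THTH$ and $HTHT$ do not nest in $\Delta_n$. Then pairs of arrows of types $HTTH$ and $THHT$ do not cross in $\Delta_n$.
   Context: $P_n$ is the convex hull of $e_j-e_i$ ($i\ne j$) in $\mathbb{R}^{n+1}$. An arrow $(i,j)$, $i\ne j\in\{1,\dots,n+1\}$, with tail $i$ and head $j$, is identified with $e_j-e_i$; $V_n$ is the set of arrows. A complex on $V_n$ represents a triangulation of $\partial P_n$ if the convex hulls of its faces form a triangulation of $\partial P_n$. A flag complex on $V_n$ is uniform if whether a pair $\{(i_1,j_1),(i_2,j_2)\}$ is an edge depends only on the equalities and inequalities among $i_1,i_2,j_1,j_2$. For two arrows with four distinct endpoints $p_1<\dots<p_4$, the type is the $T/H$ word recording tails/heads at $p_1,\dots,p_4$; the pair nests if it joins $\{p_1,p_4\},\{p_2,p_3\}$, crosses if it joins $\{p_1,p_3\},\{p_2,p_4\}$. "Type $W$ does not nest" means no nesting pair of type $W$ is an edge; "does not cross" means no crossing pair of type $W$ is an edge; "cross" means crossing pairs of that type are edges. -}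

module Defs where

open import Data.Nat using (ℕ; zero; suc)
open import Data.Fin using (Fin; zero; suc; _<_; _≟_)
open import Data.Rational using (ℚ; 0ℚ; 1ℚ; _+_; _*_; _-_)
  renaming (_≤_ to _≤ℚ_; _<_ to _<ℚ_)
open import Data.List using (List; length; lookup)
open import Data.List.Relation.Unary.All using (All)
open import Data.List.Relation.Unary.AllPairs using (AllPairs)
open import Data.List.Membership.Propositional using (_∈_)
open import Data.Vec using (Vec; _∷_; [])
open import Data.Product using (Σ; ∃; _×_; _,_)
open import Data.Sum using (_⊎_)
open import Relation.Nullary using (¬_; yes; no)
open import Relation.Binary.PropositionalEquality using (_≡_; _≢_)

-- The points 1,…,n+1 are represented by Fin (suc n), ordered
-- by the usual order on Fin.  An arrow (i , j) has tail i and head j,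
-- i ≢ j (irrelevant field, so arrows are equal iff tails and heads are).

record Arrow (m : ℕ) : Set where
  constructor arr
  field
    tail : Fin m
    head : Fin m
    .distinct : tail ≢ head
open Arrow public

Σℚ : ∀ {k} → (Fin k → ℚ) → ℚ
Σℚ {zero}  f = 0ℚ
Σℚ {suc k} f = f zero + Σℚ (λ i → f (suc i))

e : ∀ {m} → Fin m → Fin m → ℚ
e i k with i ≟ k
... | yes _ = 1ℚ
... | no  _ = 0ℚ

vec : ∀ {m} → Arrow m → Fin m → ℚ
vec a k = e (head a) k - e (tail a) k

dot : ∀ {m} → (Fin m → ℚ) → (Fin m → ℚ) → ℚ
dot x y = Σℚ (λ k → x k * y k)

InConv : ∀ {m} → List (Arrow m) → (Fin m → ℚ) → Set
InConv L x =
  Σ (Fin (length L) → ℚ) λ λs →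
    (∀ k → 0ℚ ≤ℚ λs k) × (Σℚ λs ≡ 1ℚ) ×
    (∀ c → Σℚ (λ k → λs k * vec (lookup L k) c) ≡ x c)

AffIndep : ∀ {m} → List (Arrow m) → Set
AffIndep L =
  ∀ (μ : Fin (length L) → ℚ) → Σℚ μ ≡ 0ℚ →
    (∀ c → Σℚ (λ k → μ k * vec (lookup L k) c) ≡ 0ℚ) →
    ∀ k → μ k ≡ 0ℚ

-- P_n = conv{ e_j - e_i } (n = m - 1): convex hull of all arrows,
-- i.e. union of convex hulls of finite sets of arrows
InP : ∀ {m} → (Fin m → ℚ) → Set
InP {m} x = Σ (List (Arrow m)) λ L → InConv L x

-- relative boundary of P_n: points of P_n lying on a proper face, i.e.
-- on a supporting hyperplane c·y ≤ c·x (y ∈ P_n) not containing P_n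
InBoundary : ∀ {m} → (Fin m → ℚ) → Set
InBoundary {m} x =
  InP x ×
  Σ (Fin m → ℚ) λ c →
    (∀ (a : Arrow m) → dot c (vec a) ≤ℚ dot c x) ×
    Σ (Arrow m) λ a → dot c (vec a) <ℚ dot c x

-- Flag complexes on V_n, given by their edge relation (1-skeleton);
-- faces are exactly the cliques (finite lists of pairwise adjacent arrows)

record IsFlagGraph {m : ℕ} (E : Arrow m → Arrow m → Set) : Set where
  field
    sym    : ∀ {a b} → E a b → E b a
    irrefl : ∀ {a} → ¬ E a a

Face : ∀ {m} → (Arrow m → Arrow m → Set) → List (Arrow m) → Set
Face E F = AllPairs E F

record RepresentsTriangulation {m : ℕ} (E : Arrow m → Arrow m → Set) : Set where
  field
    simplices : ∀ F → Face E F → AffIndep F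
    inside    : ∀ F → Face E F → ∀ x → InConv F x → InBoundary x
    covers    : ∀ x → InBoundary x → Σ (List (Arrow m)) λ F → Face E F × InConv F x
    -- conv F ∩ conv G = conv (F ∩ G)  (⊇ is automatic)
    meet      : ∀ F G → Face E F → Face E G → ∀ x → InConv F x → InConv G x →
                Σ (List (Arrow m)) λ H → All (λ v → v ∈ F × v ∈ G) H × InConv H x

quad : ∀ {m} → Arrow m → Arrow m → Fin 4 → Fin m
quad a b zero                   = tail a
quad a b (suc zero)             = head a
quad a b (suc (suc zero))       = tail b
quad a b (suc (suc (suc zero))) = head b

SameOrderType : ∀ {m} → Arrow m → Arrow m → Arrow m → Arrow m → Set
SameOrderType a b a′ b′ =
  ∀ k l → (quad a b k < quad a b l → quad a′ b′ k < quad a′ b′ l) ×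
          (quad a′ b′ k < quad a′ b′ l → quad a b k < quad a b l)

Uniform : ∀ {m} → (Arrow m → Arrow m → Set) → Set
Uniform {m} E = ∀ (a b a′ b′ : Arrow m) → SameOrderType a b a′ b′ → E a b → E a′ b′

data Letter : Set where
  T H : Letter

HasLetter : ∀ {m} → Arrow m → Arrow m → Fin m → Letter → Set
HasLetter a b p T = p ≡ tail a ⊎ p ≡ tail b
HasLetter a b p H = p ≡ head a ⊎ p ≡ head b

-- the endpoints of a and b are p1 < p2 < p3 < p4 (forced, since the four
-- distinct p's each equal one of the four endpoints) and the T/H word is W
HasType : ∀ {m} → Vec Letter 4 → Arrow m → Arrow m → (p1 p2 p3 p4 : Fin m) → Set
HasType (w1 ∷ w2 ∷ w3 ∷ w4 ∷ []) a b p1 p2 p3 p4 =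
  p1 < p2 × p2 < p3 × p3 < p4 ×
  HasLetter a b p1 w1 × HasLetter a b p2 w2 × HasLetter a b p3 w3 × HasLetter a b p4 w4

Joins : ∀ {m} → Arrow m → Fin m → Fin m → Set
Joins a x y = (tail a ≡ x × head a ≡ y) ⊎ (tail a ≡ y × head a ≡ x)

Nesting : ∀ {m} → Arrow m → Arrow m → (p1 p2 p3 p4 : Fin m) → Set
Nesting a b p1 p2 p3 p4 =
  (Joins a p1 p4 × Joins b p2 p3) ⊎ (Joins b p1 p4 × Joins a p2 p3)

Crossing : ∀ {m} → Arrow m → Arrow m → (p1 p2 p3 p4 : Fin m) → Set
Crossing a b p1 p2 p3 p4 =
  (Joins a p1 p3 × Joins b p2 p4) ⊎ (Joins b p1 p3 × Joins a p2 p4)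

DoesNotNest : ∀ {m} → Vec Letter 4 → (Arrow m → Arrow m → Set) → Set
DoesNotNest {m} W E =
  ∀ (a b : Arrow m) (p1 p2 p3 p4 : Fin m) →
    HasType W a b p1 p2 p3 p4 → Nesting a b p1 p2 p3 p4 → ¬ E a b

DoesNotCross : ∀ {m} → Vec Letter 4 → (Arrow m → Arrow m → Set) → Set
DoesNotCross {m} W E =
  ∀ (a b : Arrow m) (p1 p2 p3 p4 : Fin m) →
    HasType W a b p1 p2 p3 p4 → Crossing a b p1 p2 p3 p4 → ¬ E a b

module Submission where

-- Among the points 0 < 1 < 2 < 3 < 4 take the six links of K(2,3) between the
-- odd points 1 , 3 and the even points 0 , 2 , 4, oriented from odd to even
-- (type HTTH) or from even to odd (type THHT).  The sign functional
-- c = ±(1,-1,1,-1,1,0,…) is at most 2 on arrows with equality exactly on the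
-- links, so their barycentre x lies on ∂P_n and every arrow of positive weight
-- in a face whose hull contains x is a link; as x_0 , … , x_4 ≠ 0 these links
-- touch all five points.  If the crossing pair {3-0 , 1-4} is an edge then
-- {1-0 , 3-4} (same midpoint, disjoint) is not, and the hypotheses exclude the
-- nesting pairs {3-0 , 1-2} , {1-4 , 3-2}; yet every covering set of links
-- contains one of these three pairs.  Uniformity moves any crossing pair of
-- type HTTH or THHT onto {3-0 , 1-4}.

open import Defs
open import Data.Nat using (ℕ; suc; _≤_)
open import Data.Vec using (_∷_; [])
open import Data.Product using (_×_)

open import Data.Nat as ℕ using (zero; z≤n; s≤s)
import Data.Nat.Properties as ℕP
open import Data.Fin as Fin using (Fin; zero; suc; inject₁)
  renaming (_<_ to _<ᶠ_)
import Data.Fin.Properties as FinP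
open import Data.Vec using (Vec)
open import Data.Fin.Patterns using (0F; 1F; 2F; 3F; 4F)
import Data.Integer as ℤ
open import Data.Rational as ℚ using (ℚ; 0ℚ; 1ℚ; ½; _+_; _*_; _-_; -_; _/_; 1/_)
  renaming (_≤_ to _≤ℚ_; _<_ to _<ℚ_)
import Data.Rational.Properties as ℚP
open import Data.Rational.Solver using (module +-*-Solver)
open import Algebra.Bundles using (CommutativeRing)
open import Algebra.Properties.Semiring.Sum (CommutativeRing.semiring ℚP.+-*-commutativeRing)
  using (sum; sum-remove; sum-cong-≗; sum-replicate-zero; ∑-comm; ∑-distrib-+;
         *-distribˡ-sum; *-distribʳ-sum)
open import Data.Product using (Σ; ∃; _,_; proj₁; proj₂; swap)
open import Data.Sum as Sum using (_⊎_; inj₁; inj₂)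
open import Data.Maybe using (Maybe; just; nothing; maybe)
open import Data.Maybe.Properties using (just-injective)
open import Data.Empty using (⊥; ⊥-elim)
open import Data.List using (List; []; _∷_; lookup; length; map)
import Data.List.Relation.Unary.All as All
open import Data.List.Relation.Unary.AllPairs using ([]; _∷_)
open import Data.List.Relation.Unary.Any using (here; there)
open import Data.List.Membership.Propositional using (_∈_)
open import Data.List.Membership.Propositional.Properties using (∈-lookup; ∈-AllPairs₂)
open import Function using (_∘_; id)
open import Relation.Nullary using (¬_; Dec; yes; no)
open import Relation.Nullary.Decidable using (from-yes)
open import Relation.Binary.Definitions using (tri<; tri≈; tri>)
open import Relation.Binary.PropositionalEquality

Σ≡sum : ∀ {n} (f : Fin n → ℚ) → Σℚ f ≡ sum f
Σ≡sum {zero}  f = refl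
Σ≡sum {suc n} f = cong (f zero +_) (Σ≡sum (λ i → f (suc i)))

Σ-cong : ∀ {n} {f g : Fin n → ℚ} → (∀ i → f i ≡ g i) → Σℚ f ≡ Σℚ g
Σ-cong {f = f} {g} f≗g = trans (Σ≡sum f) (trans (sum-cong-≗ f≗g) (sym (Σ≡sum g)))

Σ-distrib-+ : ∀ {n} (f g : Fin n → ℚ) → Σℚ (λ i → f i + g i) ≡ Σℚ f + Σℚ g
Σ-distrib-+ f g = trans (Σ≡sum (λ i → f i + g i))
  (trans (∑-distrib-+ f g) (sym (cong₂ _+_ (Σ≡sum f) (Σ≡sum g))))

Σ-*ˡ : ∀ {n} (q : ℚ) (f : Fin n → ℚ) → q * Σℚ f ≡ Σℚ (λ i → q * f i)
Σ-*ˡ q f = trans (cong (q *_) (Σ≡sum f)) (trans (*-distribˡ-sum q f) (sym (Σ≡sum (λ i → q * f i))))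

Σ-*ʳ : ∀ {n} (q : ℚ) (f : Fin n → ℚ) → Σℚ f * q ≡ Σℚ (λ i → f i * q)
Σ-*ʳ q f = trans (cong (_* q) (Σ≡sum f)) (trans (*-distribʳ-sum q f) (sym (Σ≡sum (λ i → f i * q))))

-- Negation is not covered by the semiring lemmas.
Σ-neg : ∀ {n} (f : Fin n → ℚ) → Σℚ (λ i → - f i) ≡ - Σℚ f
Σ-neg {zero}  f = refl
Σ-neg {suc n} f = trans (cong (- f zero +_) (Σ-neg (λ i → f (suc i))))
                        (sym (ℚP.neg-distrib-+ (f zero) _))

Σ-comm : ∀ {m n} (f : Fin m → Fin n → ℚ) →
         Σℚ (λ i → Σℚ (f i)) ≡ Σℚ (λ j → Σℚ (λ i → f i j))
Σ-comm f = begin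
  Σℚ (λ i → Σℚ (f i))                ≡⟨ Σ≡sum (λ i → Σℚ (f i)) ⟩
  sum (λ i → Σℚ (f i))               ≡⟨ sum-cong-≗ (λ i → Σ≡sum (f i)) ⟩
  sum (λ i → sum (f i))              ≡⟨ ∑-comm f ⟩
  sum (λ j → sum (λ i → f i j))      ≡⟨ sum-cong-≗ (λ j → Σ≡sum (λ i → f i j)) ⟨
  sum (λ j → Σℚ (λ i → f i j))       ≡⟨ Σ≡sum (λ j → Σℚ (λ i → f i j)) ⟨
  Σℚ (λ j → Σℚ (λ i → f i j))        ∎
  where open ≡-Reasoning

Σ-single : ∀ {n} (f : Fin n → ℚ) (i : Fin n) → (∀ k → k ≢ i → f k ≡ 0ℚ) → Σℚ f ≡ f i
Σ-single {suc n} f i vanish = begin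
  Σℚ f                                  ≡⟨ Σ≡sum f ⟩
  sum f                                 ≡⟨ sum-remove {i = i} f ⟩
  f i + sum (λ k → f (Fin.punchIn i k)) ≡⟨ cong (f i +_) (sum-cong-≗ λ k →
                                             vanish _ (FinP.punchInᵢ≢i i k)) ⟩
  f i + sum {n} (λ _ → 0ℚ)              ≡⟨ cong (f i +_) (sum-replicate-zero n) ⟩
  f i + 0ℚ                              ≡⟨ ℚP.+-identityʳ (f i) ⟩
  f i                                   ∎
  where open ≡-Reasoning

Σ-mono-≤ : ∀ {n} {f g : Fin n → ℚ} → (∀ i → f i ≤ℚ g i) → Σℚ f ≤ℚ Σℚ g
Σ-mono-≤ {zero}  f≤g = ℚP.≤-refl
Σ-mono-≤ {suc n} f≤g = ℚP.+-mono-≤ (f≤g zero) (Σ-mono-≤ (λ i → f≤g (suc i)))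

Σ-mono-< : ∀ {n} {f g : Fin n → ℚ} → (∀ i → f i ≤ℚ g i) → ∀ i → f i <ℚ g i → Σℚ f <ℚ Σℚ g
Σ-mono-< f≤g zero    f<g = ℚP.+-mono-<-≤ f<g (Σ-mono-≤ (λ i → f≤g (suc i)))
Σ-mono-< f≤g (suc i) f<g = ℚP.+-mono-≤-< (f≤g zero) (Σ-mono-< (λ i → f≤g (suc i)) i f<g)

Σ-tight : ∀ {n} {f g : Fin n → ℚ} → (∀ i → f i ≤ℚ g i) → Σℚ f ≡ Σℚ g → ∀ i → f i ≡ g i
Σ-tight {f = f} {g} f≤g Σf≡Σg i with ℚP.<-cmp (f i) (g i)
... | tri< f<g _ _ = ⊥-elim (ℚP.<-irrefl Σf≡Σg (Σ-mono-< f≤g i f<g))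
... | tri≈ _ f≡g _ = f≡g
... | tri> _ _ g<f = ⊥-elim (ℚP.<-irrefl refl (ℚP.<-≤-trans g<f (f≤g i)))

Σ-nonzero : ∀ {n} (f : Fin n → ℚ) → Σℚ f ≢ 0ℚ → ∃ λ i → f i ≢ 0ℚ
Σ-nonzero {zero}  f Σ≢0 = ⊥-elim (Σ≢0 refl)
Σ-nonzero {suc n} f Σ≢0 with f zero ℚ.≟ 0ℚ
... | no f₀≢0 = zero , f₀≢0
... | yes f₀≡0 with Σ-nonzero (λ i → f (suc i))
                      (λ rest≡0 → Σ≢0 (trans (cong₂ _+_ f₀≡0 rest≡0) (ℚP.+-identityʳ 0ℚ)))
...   | i , fᵢ≢0 = suc i , fᵢ≢0

*-cancelˡ : ∀ {r p q : ℚ} → r ≢ 0ℚ → r * p ≡ r * q → p ≡ q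
*-cancelˡ {r} {p} {q} r≢0 rp≡rq = begin
  p                  ≡⟨ ℚP.*-identityˡ p ⟨
  1ℚ * p             ≡⟨ cong (_* p) (ℚP.*-inverseˡ r) ⟨
  (1/ r * r) * p     ≡⟨ ℚP.*-assoc (1/ r) r p ⟩
  1/ r * (r * p)     ≡⟨ cong (1/ r *_) rp≡rq ⟩
  1/ r * (r * q)     ≡⟨ ℚP.*-assoc (1/ r) r q ⟨
  (1/ r * r) * q     ≡⟨ cong (_* q) (ℚP.*-inverseˡ r) ⟩
  1ℚ * q             ≡⟨ ℚP.*-identityˡ q ⟩
  q                  ∎
  where
  open ≡-Reasoning
  instance r-nonZero : ℚ.NonZero r
  r-nonZero = ℚ.≢-nonZero r≢0

e-diag : ∀ {m} (i : Fin m) → e i i ≡ 1ℚ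
e-diag i with i Fin.≟ i
... | yes _   = refl
... | no i≢i = ⊥-elim (i≢i refl)

e-off : ∀ {m} {i k : Fin m} → i ≢ k → e i k ≡ 0ℚ
e-off {i = i} {k} i≢k with i Fin.≟ k
... | yes i≡k = ⊥-elim (i≢k i≡k)
... | no _    = refl

Σ-sift : ∀ {m} (f : Fin m → ℚ) (i : Fin m) → Σℚ (λ k → f k * e i k) ≡ f i
Σ-sift f i = trans (Σ-single (λ k → f k * e i k) i vanish)
                   (trans (cong (f i *_) (e-diag i)) (ℚP.*-identityʳ (f i)))
  where
  vanish : ∀ k → k ≢ i → f k * e i k ≡ 0ℚ
  vanish k k≢i = trans (cong (f k *_) (e-off (k≢i ∘ sym))) (ℚP.*-zeroʳ (f k))

dot-cong : ∀ {m} (c : Fin m → ℚ) {x y : Fin m → ℚ} → (∀ j → x j ≡ y j) → dot c x ≡ dot c y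
dot-cong c x≗y = Σ-cong (λ j → cong (c j *_) (x≗y j))

dot-vec : ∀ {m} (c : Fin m → ℚ) (a : Arrow m) → dot c (vec a) ≡ c (head a) - c (tail a)
dot-vec c a = begin
  Σℚ (λ k → c k * (e h k - e t k))             ≡⟨ Σ-cong (λ k → distrib (c k) (e h k) (e t k)) ⟩
  Σℚ (λ k → c k * e h k + - (c k * e t k))     ≡⟨ Σ-distrib-+ (λ k → c k * e h k) (λ k → - (c k * e t k)) ⟩
  Σℚ (λ k → c k * e h k) + Σℚ (λ k → - (c k * e t k))
                                               ≡⟨ cong (Σℚ (λ k → c k * e h k) +_) (Σ-neg (λ k → c k * e t k)) ⟩
  Σℚ (λ k → c k * e h k) + - Σℚ (λ k → c k * e t k)
                                               ≡⟨ cong₂ (λ p q → p + - q) (Σ-sift c h) (Σ-sift c t) ⟩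
  c h - c t                                    ∎
  where
  open ≡-Reasoning
  open +-*-Solver
  h = head a
  t = tail a
  distrib : ∀ x y z → x * (y - z) ≡ x * y + - (x * z)
  distrib = solve 3 (λ x y z → x :* (y :- z) := x :* y :+ :- (x :* z)) refl

dot-combination : ∀ {m l} (c : Fin m → ℚ) (μ : Fin l → ℚ) (v : Fin l → Fin m → ℚ) →
  dot c (λ j → Σℚ (λ k → μ k * v k j)) ≡ Σℚ (λ k → μ k * dot c (v k))
dot-combination c μ v = begin
  Σℚ (λ j → c j * Σℚ (λ k → μ k * v k j))    ≡⟨ Σ-cong (λ j → Σ-*ˡ (c j) (λ k → μ k * v k j)) ⟩
  Σℚ (λ j → Σℚ (λ k → c j * (μ k * v k j)))  ≡⟨ Σ-comm (λ j k → c j * (μ k * v k j)) ⟩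
  Σℚ (λ k → Σℚ (λ j → c j * (μ k * v k j)))  ≡⟨ Σ-cong (λ k → Σ-cong (λ j → exchange (c j) (μ k) (v k j))) ⟩
  Σℚ (λ k → Σℚ (λ j → μ k * (c j * v k j)))  ≡⟨ Σ-cong (λ k → Σ-*ˡ (μ k) (λ j → c j * v k j)) ⟨
  Σℚ (λ k → μ k * dot c (v k))               ∎
  where
  open ≡-Reasoning
  open +-*-Solver
  exchange : ∀ x y z → x * (y * z) ≡ y * (x * z)
  exchange = solve 3 (λ x y z → x :* (y :* z) := y :* (x :* z)) refl

face-support : ∀ {m} (c : Fin m → ℚ) (top : ℚ) {F : List (Arrow m)} {x : Fin m → ℚ} →
  (∀ a → dot c (vec a) ≤ℚ top) → dot c x ≡ top → (w : InConv F x) →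
  ∀ k → proj₁ w k ≢ 0ℚ → dot c (vec (lookup F k)) ≡ top
face-support {m} c top {F} {x} bound value (λs , λs≥0 , Σλs≡1 , combination) k λₖ≢0 =
  *-cancelˡ λₖ≢0 (Σ-tight weighted≤ sums-agree k)
  where
  open ≡-Reasoning
  v : Fin (length F) → Fin m → ℚ
  v k = vec (lookup F k)
  weighted≤ : ∀ k → λs k * dot c (v k) ≤ℚ λs k * top
  weighted≤ k = ℚP.*-monoˡ-≤-nonNeg (λs k) {{ℚ.nonNegative (λs≥0 k)}} (bound (lookup F k))
  sums-agree : Σℚ (λ k → λs k * dot c (v k)) ≡ Σℚ (λ k → λs k * top)
  sums-agree = begin
    Σℚ (λ k → λs k * dot c (v k))              ≡⟨ dot-combination c λs v ⟨
    dot c (λ j → Σℚ (λ k → λs k * v k j))      ≡⟨ dot-cong c combination ⟩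
    dot c x                                    ≡⟨ value ⟩
    top                                        ≡⟨ ℚP.*-identityˡ top ⟨
    1ℚ * top                                   ≡⟨ cong (_* top) Σλs≡1 ⟨
    Σℚ λs * top                                ≡⟨ Σ-*ʳ top λs ⟩
    Σℚ (λ k → λs k * top)                      ∎

vec-support : ∀ {m} (a : Arrow m) (j : Fin m) → vec a j ≢ 0ℚ → j ≡ head a ⊎ j ≡ tail a
vec-support a j vⱼ≢0 = endpoint (head a Fin.≟ j) (tail a Fin.≟ j)
  where
  endpoint : Dec (head a ≡ j) → Dec (tail a ≡ j) → j ≡ head a ⊎ j ≡ tail a
  endpoint (yes h≡j) _         = inj₁ (sym h≡j)
  endpoint (no _)    (yes t≡j) = inj₂ (sym t≡j)
  endpoint (no h≢j)  (no t≢j)  = ⊥-elim (vⱼ≢0 (cong₂ _-_ (e-off h≢j) (e-off t≢j)))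

coordinate-support : ∀ {m} {F : List (Arrow m)} {x : Fin m → ℚ} (w : InConv F x) (j : Fin m) →
  x j ≢ 0ℚ → Σ (Fin (length F)) λ k → proj₁ w k ≢ 0ℚ × (j ≡ head (lookup F k) ⊎ j ≡ tail (lookup F k))
coordinate-support {F = F} (λs , _ , _ , combination) j xⱼ≢0
  with Σ-nonzero (λ k → λs k * vec (lookup F k) j) (λ Σ≡0 → xⱼ≢0 (trans (sym (combination j)) Σ≡0))
... | k , term≢0 =
  k , (λ λₖ≡0 → term≢0 (trans (cong (_* vec (lookup F k) j) λₖ≡0) (ℚP.*-zeroˡ (vec (lookup F k) j)))) ,
      vec-support (lookup F k) j (λ vⱼ≡0 → term≢0 (trans (cong (λs k *_) vⱼ≡0) (ℚP.*-zeroʳ (λs k))))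

face-edge : ∀ {m} {E : Arrow m → Arrow m → Set} {F : List (Arrow m)} {a b : Arrow m} →
  IsFlagGraph E → Face E F → a ∈ F → b ∈ F → a ≢ b → E a b
face-edge flag face a∈F b∈F a≢b with ∈-AllPairs₂ face a∈F b∈F
... | inj₁ a≡b        = ⊥-elim (a≢b a≡b)
... | inj₂ (inj₁ Eab) = Eab
... | inj₂ (inj₂ Eba) = IsFlagGraph.sym flag Eba

midpoint : ∀ {m} → Arrow m → Arrow m → Fin m → ℚ
midpoint a b j = ½ * vec a j + (½ * vec b j + 0ℚ)

InConv-resp : ∀ {m} {F : List (Arrow m)} {x y : Fin m → ℚ} →
  InConv F x → (∀ j → x j ≡ y j) → InConv F y
InConv-resp (λs , λs≥0 , Σλs≡1 , combination) x≗y =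
  λs , λs≥0 , Σλs≡1 , λ j → trans (combination j) (x≗y j)

midpoint-in-hull : ∀ {m} (a b : Arrow m) → InConv (a ∷ b ∷ []) (midpoint a b)
midpoint-in-hull a b = (λ _ → ½) , (λ _ → from-yes (0ℚ ℚ.≤? ½)) , refl , (λ _ → refl)

-- Two edges of the triangulation whose segments have the same midpoint
-- share an endpoint: the hulls meet in the hull of their common vertices.
edges-sharing-midpoint : ∀ {m} {E : Arrow m → Arrow m → Set} → RepresentsTriangulation E →
  ∀ {a b a′ b′} → E a b → E a′ b′ → (∀ j → midpoint a b j ≡ midpoint a′ b′ j) →
  a ≢ a′ → a ≢ b′ → b ≢ a′ → b ≢ b′ → ⊥
edges-sharing-midpoint tri {a} {b} {a′} {b′} Eab Ea′b′ same a≢a′ a≢b′ b≢a′ b≢b′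
  with RepresentsTriangulation.meet tri (a ∷ b ∷ []) (a′ ∷ b′ ∷ [])
         ((Eab All.∷ All.[]) ∷ (All.[] ∷ [])) ((Ea′b′ All.∷ All.[]) ∷ (All.[] ∷ []))
         (midpoint a b) (midpoint-in-hull a b)
         (InConv-resp {F = a′ ∷ b′ ∷ []} {midpoint a′ b′} (midpoint-in-hull a′ b′) (λ j → sym (same j)))
... | [] , _ , (_ , _ , Σ∅≡1 , _) = ℚP.1≢0 (sym Σ∅≡1)
... | v ∷ _ , ((v∈ab , v∈a′b′) All.∷ _) , _ = common v∈ab v∈a′b′
  where
  common : ∀ {v} → v ∈ a ∷ b ∷ [] → v ∈ a′ ∷ b′ ∷ [] → ⊥
  common (here v≡a)         (here v≡a′)         = a≢a′ (trans (sym v≡a) v≡a′)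
  common (here v≡a)         (there (here v≡b′)) = a≢b′ (trans (sym v≡a) v≡b′)
  common (there (here v≡b)) (here v≡a′)         = b≢a′ (trans (sym v≡b) v≡a′)
  common (there (here v≡b)) (there (here v≡b′)) = b≢b′ (trans (sym v≡b) v≡b′)

exchange-heads : ∀ {m} (a b a′ b′ : Arrow m) →
  tail a′ ≡ tail a → head a′ ≡ head b → tail b′ ≡ tail b → head b′ ≡ head a →
  ∀ j → midpoint a b j ≡ midpoint a′ b′ j
exchange-heads a b _ _ refl refl refl refl j =
  exchange (e (head a) j) (e (tail a) j) (e (head b) j) (e (tail b) j)
  where
  open +-*-Solver
  exchange : ∀ x y z w → ½ * (x - y) + (½ * (z - w) + 0ℚ) ≡ ½ * (z - y) + (½ * (x - w) + 0ℚ)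
  exchange = solve 4 (λ x y z w → con ½ :* (x :- y) :+ (con ½ :* (z :- w) :+ con 0ℚ)
                               := con ½ :* (z :- y) :+ (con ½ :* (x :- w) :+ con 0ℚ)) refl

corners : ∀ {m} → Fin m → Fin m → Fin m → Fin m → Fin 4 → Fin m
corners p₁ p₂ p₃ p₄ 0F = p₁
corners p₁ p₂ p₃ p₄ 1F = p₂
corners p₁ p₂ p₃ p₄ 2F = p₃
corners p₁ p₂ p₃ p₄ 3F = p₄

Increasing : ∀ {n m} → (Fin (suc n) → Fin m) → Set
Increasing P = ∀ i → P (inject₁ i) <ᶠ P (suc i)

increasing-mono : ∀ {n m} {P : Fin (suc n) → Fin m} → Increasing P →
  ∀ {i j} → i <ᶠ j → P i <ᶠ P j
increasing-mono inc {zero}  {zero}        ()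
increasing-mono inc {zero}  {suc zero}    _ = inc zero
increasing-mono {n = suc n} {P = P} inc {zero} {suc (suc j)} _ =
  FinP.<-trans (inc zero) (increasing-mono {P = P ∘ suc} (inc ∘ suc) {zero} {suc j} (s≤s z≤n))
increasing-mono inc {suc i} {zero}        ()
increasing-mono {n = suc n} {P = P} inc {suc i} {suc j} (s≤s i<j) =
  increasing-mono {P = P ∘ suc} (inc ∘ suc) i<j

increasing-reflects : ∀ {n m} {P : Fin (suc n) → Fin m} → Increasing P →
  ∀ {i j} → P i <ᶠ P j → i <ᶠ j
increasing-reflects {P = P} inc {i} {j} Pi<Pj with FinP.<-cmp i j
... | tri< i<j _ _  = i<j
... | tri≈ _ refl _ = ⊥-elim (FinP.<-irrefl refl Pi<Pj)
... | tri> _ _ j<i  = ⊥-elim (FinP.<-asym Pi<Pj (increasing-mono {P = P} inc j<i))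

record Realises {m} (r : Fin 4 → Fin 4) (a b : Arrow m) (P : Fin 4 → Fin m) : Set where
  constructor realises
  field position : ∀ k → quad a b k ≡ P (r k)
open Realises

order-preserved : ∀ {m} {r : Fin 4 → Fin 4} {a b a′ b′ : Arrow m} {P Q : Fin 4 → Fin m} →
  Increasing P → Increasing Q → Realises r a b P → Realises r a′ b′ Q →
  ∀ k l → quad a b k <ᶠ quad a b l → quad a′ b′ k <ᶠ quad a′ b′ l
order-preserved {P = P} {Q} incP incQ ρ ρ′ k l lt =
  subst₂ _<ᶠ_ (sym (position ρ′ k)) (sym (position ρ′ l))
    (increasing-mono {P = Q} incQ
      (increasing-reflects {P = P} incP (subst₂ _<ᶠ_ (position ρ k) (position ρ l) lt)))

-- Pairs realising the same word in two increasing quadruples have the same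
-- order type, so a uniform complex contains both or neither.
transfer : ∀ {m} {E : Arrow m → Arrow m → Set} → Uniform E →
  ∀ {r : Fin 4 → Fin 4} {a b a′ b′ : Arrow m} {P Q : Fin 4 → Fin m} →
  Increasing P → Increasing Q → Realises r a b P → Realises r a′ b′ Q → E a b → E a′ b′
transfer uniform {r} {a} {b} {a′} {b′} {P} {Q} incP incQ ρ ρ′ =
  uniform a b a′ b′ λ k l →
    order-preserved {r = r} {P = P} {Q} incP incQ ρ ρ′ k l ,
    order-preserved {r = r} {P = Q} {P} incQ incP ρ′ ρ k l

>⇒≢ : ∀ {m} {i j : Fin m} → i <ᶠ j → j ≢ i
>⇒≢ i<j j≡i = FinP.<⇒≢ i<j (sym j≡i)

HasLetter-swap : ∀ {m} {a b : Arrow m} {p : Fin m} w → HasLetter a b p w → HasLetter b a p w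
HasLetter-swap T = Sum.swap
HasLetter-swap H = Sum.swap

HasType-swap : ∀ {m} {a b : Arrow m} {p₁ p₂ p₃ p₄ : Fin m} W →
  HasType W a b p₁ p₂ p₃ p₄ → HasType W b a p₁ p₂ p₃ p₄
HasType-swap (w₁ ∷ w₂ ∷ w₃ ∷ w₄ ∷ []) (o₁₂ , o₂₃ , o₃₄ , l₁ , l₂ , l₃ , l₄) =
  o₁₂ , o₂₃ , o₃₄ , HasLetter-swap w₁ l₁ , HasLetter-swap w₂ l₂ ,
  HasLetter-swap w₃ l₃ , HasLetter-swap w₄ l₄

HasType-increasing : ∀ {m} {a b : Arrow m} {p₁ p₂ p₃ p₄ : Fin m} W →
  HasType W a b p₁ p₂ p₃ p₄ → Increasing (corners p₁ p₂ p₃ p₄)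
HasType-increasing (_ ∷ _ ∷ _ ∷ _ ∷ []) (o₁₂ , o₂₃ , o₃₄ , _) 0F = o₁₂
HasType-increasing (_ ∷ _ ∷ _ ∷ _ ∷ []) (o₁₂ , o₂₃ , o₃₄ , _) 1F = o₂₃
HasType-increasing (_ ∷ _ ∷ _ ∷ _ ∷ []) (o₁₂ , o₂₃ , o₃₄ , _) 2F = o₃₄

crossing-normal : ∀ {m} {E : Arrow m → Arrow m → Set} → IsFlagGraph E →
  ∀ {a b : Arrow m} {p₁ p₂ p₃ p₄ : Fin m} W →
  HasType W a b p₁ p₂ p₃ p₄ → Crossing a b p₁ p₂ p₃ p₄ → E a b →
  Σ (Arrow m) λ α → Σ (Arrow m) λ β →
    HasType W α β p₁ p₂ p₃ p₄ × Joins α p₁ p₃ × Joins β p₂ p₄ × E α β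
crossing-normal flag {a} {b} W type (inj₁ (ja , jb)) Eab = a , b , type , ja , jb , Eab
crossing-normal flag {a} {b} W type (inj₂ (jb , ja)) Eab =
  b , a , HasType-swap W type , jb , ja , IsFlagGraph.sym flag Eab

Joins-sym : ∀ {m} {a : Arrow m} {x y : Fin m} → Joins a x y → Joins a y x
Joins-sym = Sum.swap

orient : ∀ {m} {a b : Arrow m} {x y u v : Fin m} → Joins a x y → Joins b u v →
  x ≢ y → x ≢ u → x ≢ v → HasLetter a b x T → tail a ≡ x × head a ≡ y
orient (inj₁ ends)        _  _   _   _   _              = ends
orient (inj₂ (ta≡y , _)) _  x≢y _   _   (inj₁ x≡ta)    = ⊥-elim (x≢y (trans x≡ta ta≡y))
orient (inj₂ _)          (inj₁ (tb≡u , _)) _ x≢u _ (inj₂ x≡tb) = ⊥-elim (x≢u (trans x≡tb tb≡u))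
orient (inj₂ _)          (inj₂ (tb≡v , _)) _ _ x≢v (inj₂ x≡tb) = ⊥-elim (x≢v (trans x≡tb tb≡v))

data Sign : Set where
  minus null plus : Sign

⟦_⟧ : Sign → ℚ
⟦ minus ⟧ = - 1ℚ
⟦ null ⟧  = 0ℚ
⟦ plus ⟧  = 1ℚ

two : ℚ
two = 1ℚ + 1ℚ

⟦⟧≤1 : ∀ s → ⟦ s ⟧ ≤ℚ 1ℚ
⟦⟧≤1 minus = from-yes (- 1ℚ ℚ.≤? 1ℚ)
⟦⟧≤1 null  = from-yes (0ℚ ℚ.≤? 1ℚ)
⟦⟧≤1 plus  = ℚP.≤-refl

-1≤⟦⟧ : ∀ s → - 1ℚ ≤ℚ ⟦ s ⟧
-1≤⟦⟧ minus = ℚP.≤-refl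
-1≤⟦⟧ null  = from-yes (- 1ℚ ℚ.≤? 0ℚ)
-1≤⟦⟧ plus  = from-yes (- 1ℚ ℚ.≤? 1ℚ)

gap≤2 : ∀ s s′ → ⟦ s ⟧ - ⟦ s′ ⟧ ≤ℚ two
gap≤2 s s′ = ℚP.+-mono-≤ (⟦⟧≤1 s) (ℚP.neg-antimono-≤ (-1≤⟦⟧ s′))

gap≡2 : ∀ s s′ → ⟦ s ⟧ - ⟦ s′ ⟧ ≡ two → s ≡ plus × s′ ≡ minus
gap≡2 plus  minus _ = refl , refl
gap≡2 minus minus ()
gap≡2 minus null  ()
gap≡2 minus plus  ()
gap≡2 null  minus ()
gap≡2 null  null  ()
gap≡2 null  plus  ()
gap≡2 plus  null  ()
gap≡2 plus  plus  ()

arrow-ext : ∀ {m} {a b : Arrow m} → tail a ≡ tail b → head a ≡ head b → a ≡ b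
arrow-ext refl refl = refl

reverse : ∀ {m} → Arrow m → Arrow m
reverse (arr t h t≢h) = arr h t (λ h≡t → t≢h (sym h≡t))

Top : ∀ {m} → (Fin m → Sign) → Arrow m → Set
Top σ a = σ (tail a) ≡ minus × σ (head a) ≡ plus

module _ {m : ℕ} (σ : Fin m → Sign) where

  c : Fin m → ℚ
  c = ⟦_⟧ ∘ σ

  value≤2 : ∀ a → dot c (vec a) ≤ℚ two
  value≤2 a = subst (_≤ℚ two) (sym (dot-vec c a)) (gap≤2 (σ (head a)) (σ (tail a)))

  top-value : ∀ {a} → Top σ a → dot c (vec a) ≡ two
  top-value {a} (t- , h+) = trans (dot-vec c a) (cong₂ (λ s s′ → ⟦ s ⟧ - ⟦ s′ ⟧) h+ t-)

  value≡2⇒top : ∀ a → dot c (vec a) ≡ two → Top σ a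
  value≡2⇒top a value≡2 = swap (gap≡2 _ _ (trans (sym (dot-vec c a)) value≡2))

  reverse-top-value : ∀ {a} → Top σ a → dot c (vec (reverse a)) <ℚ two
  reverse-top-value {a} (t- , h+) =
    subst (_<ℚ two) (sym (trans (dot-vec c (reverse a)) (cong₂ (λ s s′ → ⟦ s ⟧ - ⟦ s′ ⟧) t- h+)))
          (from-yes (⟦ minus ⟧ - ⟦ plus ⟧ ℚ.<? two))

data Odd : Set where
  odd₁ odd₃ : Odd

data Even : Set where
  even₀ even₂ even₄ : Even

Link : Set
Link = Odd × Even

-- The three pairs of links excluded from a common face: two nesting pairs
-- and the pair with the same midpoint as the crossing pair {3-0 , 1-4}.
data Conflict : Link → Link → Set where
  nested₁  : Conflict (odd₃ , even₀) (odd₁ , even₂)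
  nested₂  : Conflict (odd₁ , even₄) (odd₃ , even₂)
  parallel : Conflict (odd₁ , even₀) (odd₃ , even₄)

record Covering (In : Link → Set) : Set where
  field
    even-partner : ∀ ev → Σ Odd λ o → In (o , ev)
    odd-partner  : ∀ o → Σ Even λ ev → In (o , ev)

Point : Set
Point = Odd ⊎ Even

EndpointOf : Point → Link → Set
EndpointOf p (o , ev) = p ≡ inj₁ o ⊎ p ≡ inj₂ ev

covering : ∀ {In : Link → Set} → (∀ p → Σ Link λ l → In l × EndpointOf p l) → Covering In
covering {In} support = record { even-partner = even-partner ; odd-partner = odd-partner }
  where
  even-partner : ∀ ev → Σ Odd λ o → In (o , ev)
  even-partner ev with support (inj₂ ev)
  ... | (o , _) , l∈ , inj₂ refl = o , l∈
  ... | _ , _ , inj₁ ()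
  odd-partner : ∀ o → Σ Even λ ev → In (o , ev)
  odd-partner o with support (inj₁ o)
  ... | (_ , ev) , l∈ , inj₁ refl = ev , l∈
  ... | _ , _ , inj₂ ()

-- If the partners of 0 , 2 , 4 are not all equal, two of them conflict;
-- if they all equal one odd point, the other odd point's link conflicts.
covering-conflict : ∀ {In : Link → Set} → Covering In →
  Σ Link λ l → Σ Link λ l′ → In l × In l′ × Conflict l l′
covering-conflict cover
  with Covering.even-partner cover even₀ | Covering.even-partner cover even₂
     | Covering.even-partner cover even₄
... | odd₃ , i₀ | odd₁ , i₂ | _         = _ , _ , i₀ , i₂ , nested₁
... | odd₁ , i₀ | _         | odd₃ , i₄ = _ , _ , i₀ , i₄ , parallel
... | _         | odd₃ , i₂ | odd₁ , i₄ = _ , _ , i₄ , i₂ , nested₂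
... | odd₁ , i₀ | odd₁ , i₂ | odd₁ , i₄ with Covering.odd-partner cover odd₃
...   | even₀ , j = _ , _ , j  , i₂ , nested₁
...   | even₂ , j = _ , _ , i₄ , j  , nested₂
...   | even₄ , j = _ , _ , i₀ , j  , parallel
covering-conflict cover
    | odd₃ , i₀ | odd₃ , i₂ | odd₃ , i₄ with Covering.odd-partner cover odd₁
...   | even₀ , j = _ , _ , j  , i₄ , parallel
...   | even₂ , j = _ , _ , i₀ , j  , nested₁
...   | even₄ , j = _ , _ , j  , i₂ , nested₂

-- The links of K(2,3) all run from odd to even points, or all from even to
-- odd; the crossing pair {3-0 , 1-4} then has type HTTH, resp. THHT.
data Orientation : Set where
  fromOdd fromEven : Orientation

crossType : Orientation → Vec Letter 4
crossType fromOdd  = H ∷ T ∷ T ∷ H ∷ []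
crossType fromEven = T ∷ H ∷ H ∷ T ∷ []

-- Positions of (tail α , head α , tail β , head β) for a crossing pair (α , β)
-- with α joining the first and third points: HTTH is 3-1 , 2-4 and THHT is 1-3 , 4-2.
crossRoles : Orientation → Fin 4 → Fin 4
crossRoles fromOdd  0F = 2F
crossRoles fromOdd  1F = 0F
crossRoles fromOdd  2F = 1F
crossRoles fromOdd  3F = 3F
crossRoles fromEven 0F = 0F
crossRoles fromEven 1F = 2F
crossRoles fromEven 2F = 3F
crossRoles fromEven 3F = 1F

crossing-roles : ∀ d {m} {α β : Arrow m} {p₁ p₂ p₃ p₄ : Fin m} →
  HasType (crossType d) α β p₁ p₂ p₃ p₄ → Joins α p₁ p₃ → Joins β p₂ p₄ →
  Realises (crossRoles d) α β (corners p₁ p₂ p₃ p₄)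
crossing-roles fromOdd {α = α} {β} {p₁} {p₂} {p₃} {p₄} (o₁₂ , o₂₃ , o₃₄ , _ , l₂ , l₃ , _) jα jβ =
  realises λ { 0F → proj₁ α-ends ; 1F → proj₂ α-ends ; 2F → proj₁ β-ends ; 3F → proj₂ β-ends }
  where
  α-ends : tail α ≡ p₃ × head α ≡ p₁
  α-ends = orient {a = α} {β} (Joins-sym {a = α} jα) jβ
             (>⇒≢ (FinP.<-trans o₁₂ o₂₃)) (>⇒≢ o₂₃) (FinP.<⇒≢ o₃₄) l₃
  β-ends : tail β ≡ p₂ × head β ≡ p₄
  β-ends = orient {a = β} {α} jβ jα
             (FinP.<⇒≢ (FinP.<-trans o₂₃ o₃₄)) (>⇒≢ o₁₂) (FinP.<⇒≢ o₂₃)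
             (HasLetter-swap {a = α} {β} T l₂)
crossing-roles fromEven {α = α} {β} {p₁} {p₂} {p₃} {p₄} (o₁₂ , o₂₃ , o₃₄ , l₁ , _ , _ , l₄) jα jβ =
  realises λ { 0F → proj₁ α-ends ; 1F → proj₂ α-ends ; 2F → proj₁ β-ends ; 3F → proj₂ β-ends }
  where
  o₁₄ : p₁ <ᶠ p₄
  o₁₄ = FinP.<-trans o₁₂ (FinP.<-trans o₂₃ o₃₄)
  α-ends : tail α ≡ p₁ × head α ≡ p₃
  α-ends = orient {a = α} {β} jα jβ
             (FinP.<⇒≢ (FinP.<-trans o₁₂ o₂₃)) (FinP.<⇒≢ o₁₂) (FinP.<⇒≢ o₁₄) l₁
  β-ends : tail β ≡ p₄ × head β ≡ p₂
  β-ends = orient {a = β} {α} (Joins-sym {a = β} jβ) jα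
             (>⇒≢ (FinP.<-trans o₂₃ o₃₄)) (>⇒≢ o₁₄) (>⇒≢ o₃₄)
             (HasLetter-swap {a = α} {β} T l₄)

module FivePoints (k : ℕ) where

  M : ℕ
  M = 5 ℕ.+ k

  ⌊_⌋ : Point → Fin M
  ⌊ inj₂ even₀ ⌋ = 0F
  ⌊ inj₁ odd₁ ⌋  = 1F
  ⌊ inj₂ even₂ ⌋ = 2F
  ⌊ inj₁ odd₃ ⌋  = 3F
  ⌊ inj₂ even₄ ⌋ = 4F

  classify : Fin M → Maybe Point
  classify 0F = just (inj₂ even₀)
  classify 1F = just (inj₁ odd₁)
  classify 2F = just (inj₂ even₂)
  classify 3F = just (inj₁ odd₃)
  classify 4F = just (inj₂ even₄)
  classify (suc (suc (suc (suc (suc _))))) = nothing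

  classify-⌊⌋ : ∀ p → classify ⌊ p ⌋ ≡ just p
  classify-⌊⌋ (inj₂ even₀) = refl
  classify-⌊⌋ (inj₁ odd₁)  = refl
  classify-⌊⌋ (inj₂ even₂) = refl
  classify-⌊⌋ (inj₁ odd₃)  = refl
  classify-⌊⌋ (inj₂ even₄) = refl

  classify-retract : ∀ {j p} → classify j ≡ just p → j ≡ ⌊ p ⌋
  classify-retract {0F} refl = refl
  classify-retract {1F} refl = refl
  classify-retract {2F} refl = refl
  classify-retract {3F} refl = refl
  classify-retract {4F} refl = refl
  classify-retract {suc (suc (suc (suc (suc _))))} ()

  ⌊⌋-injective : ∀ {p q} → ⌊ p ⌋ ≡ ⌊ q ⌋ → p ≡ q
  ⌊⌋-injective {p} {q} eq =
    just-injective (trans (sym (classify-⌊⌋ p)) (trans (cong classify eq) (classify-⌊⌋ q)))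

  odd≢even : ∀ o ev → ⌊ inj₁ o ⌋ ≢ ⌊ inj₂ ev ⌋
  odd≢even o ev eq with ⌊⌋-injective {inj₁ o} {inj₂ ev} eq
  ... | ()

  link : Orientation → Link → Arrow M
  link fromOdd  (o , ev) = arr ⌊ inj₁ o ⌋ ⌊ inj₂ ev ⌋ (odd≢even o ev)
  link fromEven (o , ev) = arr ⌊ inj₂ ev ⌋ ⌊ inj₁ o ⌋ (odd≢even o ev ∘ sym)

  -- The sign functional maximised exactly by the links: tails are minus,
  -- heads are plus, and all points other than 0 , … , 4 are null.
  role : Orientation → Point → Sign
  role fromOdd  (inj₁ _) = minus
  role fromOdd  (inj₂ _) = plus
  role fromEven (inj₁ _) = plus
  role fromEven (inj₂ _) = minus

  σ : Orientation → Fin M → Sign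
  σ d j = maybe (role d) null (classify j)

  σ-⌊⌋ : ∀ d p → σ d ⌊ p ⌋ ≡ role d p
  σ-⌊⌋ d p = cong (maybe (role d) null) (classify-⌊⌋ p)

  signed-point : ∀ d {j s} → σ d j ≡ s → s ≢ null → Σ Point λ p → j ≡ ⌊ p ⌋ × role d p ≡ s
  signed-point d {j} σj≡s s≢null with classify j in class
  ... | just p  = p , classify-retract class , σj≡s
  ... | nothing = ⊥-elim (s≢null (sym σj≡s))

  link-top : ∀ d l → Top (σ d) (link d l)
  link-top fromOdd  (o , ev) = σ-⌊⌋ fromOdd (inj₁ o) , σ-⌊⌋ fromOdd (inj₂ ev)
  link-top fromEven (o , ev) = σ-⌊⌋ fromEven (inj₂ ev) , σ-⌊⌋ fromEven (inj₁ o)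

  roles⇒link : ∀ d p q → role d p ≡ minus → role d q ≡ plus →
    Σ Link λ l → tail (link d l) ≡ ⌊ p ⌋ × head (link d l) ≡ ⌊ q ⌋
  roles⇒link fromOdd  (inj₁ o)  (inj₂ ev) _  _  = (o , ev) , refl , refl
  roles⇒link fromOdd  (inj₂ _)  _         () _
  roles⇒link fromOdd  (inj₁ _)  (inj₁ _)  _  ()
  roles⇒link fromEven (inj₂ ev) (inj₁ o)  _  _  = (o , ev) , refl , refl
  roles⇒link fromEven (inj₁ _)  _         () _
  roles⇒link fromEven (inj₂ _)  (inj₂ _)  _  ()

  top⇒link : ∀ d a → Top (σ d) a → Σ Link λ l → a ≡ link d l
  top⇒link d a (t- , h+) with signed-point d t- (λ ()) | signed-point d h+ (λ ())
  ... | p , t≡p , role-p | q , h≡q , role-q with roles⇒link d p q role-p role-q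
  ...   | l , tail≡p , head≡q = l , arrow-ext (trans t≡p (sym tail≡p)) (trans h≡q (sym head≡q))

  link-endpoint : ∀ d l {j} → j ≡ head (link d l) ⊎ j ≡ tail (link d l) →
    j ≡ ⌊ inj₁ (proj₁ l) ⌋ ⊎ j ≡ ⌊ inj₂ (proj₂ l) ⌋
  link-endpoint fromOdd  _ = Sum.swap
  link-endpoint fromEven _ = id

  allLinks : List Link
  allLinks = (odd₁ , even₀) ∷ (odd₁ , even₂) ∷ (odd₁ , even₄) ∷
             (odd₃ , even₀) ∷ (odd₃ , even₂) ∷ (odd₃ , even₄) ∷ []

  links : Orientation → List (Arrow M)
  links d = map (link d) allLinks

  sixth : ℚ
  sixth = ℤ.+ 1 / 6

  barycentre : Orientation → Fin M → ℚ
  barycentre d j = Σℚ (λ i → sixth * vec (lookup (links d) i) j)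

  barycentre-in-hull : ∀ d → InConv (links d) (barycentre d)
  barycentre-in-hull d = (λ _ → sixth) , (λ _ → from-yes (0ℚ ℚ.≤? sixth)) , refl , (λ _ → refl)

  links-top : ∀ d → All.All (Top (σ d)) (links d)
  links-top d = link-top d _ All.∷ link-top d _ All.∷ link-top d _ All.∷
                link-top d _ All.∷ link-top d _ All.∷ link-top d _ All.∷ All.[]

  barycentre-value : ∀ d → dot (c (σ d)) (barycentre d) ≡ two
  barycentre-value d =
    trans (dot-combination (c (σ d)) (λ _ → sixth) (λ i → vec (lookup (links d) i)))
          (Σ-cong (λ i → cong (sixth *_) (top-value (σ d) {lookup (links d) i}
                                            (All.lookup (links-top d) (∈-lookup i)))))

  barycentre-boundary : ∀ d → InBoundary (barycentre d)
  barycentre-boundary d =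
    (links d , barycentre-in-hull d) , c (σ d) ,
    (λ a → subst (dot (c (σ d)) (vec a) ≤ℚ_) (sym (barycentre-value d)) (value≤2 (σ d) a)) ,
    reverse a₁₀ ,
    subst (dot (c (σ d)) (vec (reverse a₁₀)) <ℚ_) (sym (barycentre-value d))
          (reverse-top-value (σ d) {a₁₀} (link-top d (odd₁ , even₀)))
    where a₁₀ = link d (odd₁ , even₀)

  barycentre-nonzero : ∀ d p → barycentre d ⌊ p ⌋ ≢ 0ℚ
  barycentre-nonzero fromOdd  (inj₁ odd₁)  ()
  barycentre-nonzero fromOdd  (inj₁ odd₃)  ()
  barycentre-nonzero fromOdd  (inj₂ even₀) ()
  barycentre-nonzero fromOdd  (inj₂ even₂) ()
  barycentre-nonzero fromOdd  (inj₂ even₄) ()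
  barycentre-nonzero fromEven (inj₁ odd₁)  ()
  barycentre-nonzero fromEven (inj₁ odd₃)  ()
  barycentre-nonzero fromEven (inj₂ even₀) ()
  barycentre-nonzero fromEven (inj₂ even₂) ()
  barycentre-nonzero fromEven (inj₂ even₄) ()

  canonical-increasing : Increasing (corners {M} 0F 1F 3F 4F)
  canonical-increasing 0F = from-yes (0 ℕ.<? 1)
  canonical-increasing 1F = from-yes (1 ℕ.<? 3)
  canonical-increasing 2F = from-yes (3 ℕ.<? 4)

  canonical-realises : ∀ d → Realises (crossRoles d) (link d (odd₃ , even₀)) (link d (odd₁ , even₄))
                                        (corners 0F 1F 3F 4F)
  canonical-realises fromOdd  = realises λ { 0F → refl ; 1F → refl ; 2F → refl ; 3F → refl }
  canonical-realises fromEven = realises λ { 0F → refl ; 1F → refl ; 2F → refl ; 3F → refl }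

  conflict-distinct : ∀ d {l l′} → Conflict l l′ → link d l ≢ link d l′
  conflict-distinct fromOdd  nested₁  ()
  conflict-distinct fromOdd  nested₂  ()
  conflict-distinct fromOdd  parallel ()
  conflict-distinct fromEven nested₁  ()
  conflict-distinct fromEven nested₂  ()
  conflict-distinct fromEven parallel ()

  module Argument {E : Arrow M → Arrow M → Set} (flag : IsFlagGraph E) (uniform : Uniform E)
    (tri : RepresentsTriangulation E)
    (noTHTH : DoesNotNest (T ∷ H ∷ T ∷ H ∷ []) E) (noHTHT : DoesNotNest (H ∷ T ∷ H ∷ T ∷ []) E)
    where

    CrossingEdge : Orientation → Set
    CrossingEdge d = E (link d (odd₃ , even₀)) (link d (odd₁ , even₄))

    -- Given the crossing edge, no conflicting pair of links is an edge:
    -- the nested pairs by hypothesis, the parallel pair by its midpoint.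
    conflict-non-edge : ∀ d → CrossingEdge d → ∀ {l l′} → Conflict l l′ → ¬ E (link d l) (link d l′)
    conflict-non-edge fromOdd _ nested₁ =
      noHTHT _ _ 0F 1F 2F 3F (ℕP.n<1+n _ , ℕP.n<1+n _ , ℕP.n<1+n _ ,
                              inj₁ refl , inj₂ refl , inj₂ refl , inj₁ refl)
             (inj₁ (inj₂ (refl , refl) , inj₁ (refl , refl)))
    conflict-non-edge fromOdd _ nested₂ =
      noTHTH _ _ 1F 2F 3F 4F (ℕP.n<1+n _ , ℕP.n<1+n _ , ℕP.n<1+n _ ,
                              inj₁ refl , inj₂ refl , inj₂ refl , inj₁ refl)
             (inj₁ (inj₁ (refl , refl) , inj₂ (refl , refl)))
    conflict-non-edge fromEven _ nested₁ =
      noTHTH _ _ 0F 1F 2F 3F (ℕP.n<1+n _ , ℕP.n<1+n _ , ℕP.n<1+n _ ,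
                              inj₁ refl , inj₂ refl , inj₂ refl , inj₁ refl)
             (inj₁ (inj₁ (refl , refl) , inj₂ (refl , refl)))
    conflict-non-edge fromEven _ nested₂ =
      noHTHT _ _ 1F 2F 3F 4F (ℕP.n<1+n _ , ℕP.n<1+n _ , ℕP.n<1+n _ ,
                              inj₁ refl , inj₂ refl , inj₂ refl , inj₁ refl)
             (inj₁ (inj₂ (refl , refl) , inj₁ (refl , refl)))
    conflict-non-edge fromOdd cross parallel E₁₀₃₄ =
      edges-sharing-midpoint tri cross (IsFlagGraph.sym flag E₁₀₃₄)
        (exchange-heads (link fromOdd (odd₃ , even₀)) (link fromOdd (odd₁ , even₄))
                        (link fromOdd (odd₃ , even₄)) (link fromOdd (odd₁ , even₀))
                        refl refl refl refl)
        (λ ()) (λ ()) (λ ()) (λ ())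
    conflict-non-edge fromEven cross parallel E₁₀₃₄ =
      edges-sharing-midpoint tri cross E₁₀₃₄
        (exchange-heads (link fromEven (odd₃ , even₀)) (link fromEven (odd₁ , even₄))
                        (link fromEven (odd₁ , even₀)) (link fromEven (odd₃ , even₄))
                        refl refl refl refl)
        (λ ()) (λ ()) (λ ()) (λ ())

    weighted-link : ∀ d {F} (w : InConv F (barycentre d)) i → proj₁ w i ≢ 0ℚ →
      Σ Link λ l → lookup F i ≡ link d l
    weighted-link d {F} w i λᵢ≢0 =
      top⇒link d (lookup F i)
        (value≡2⇒top (σ d) (lookup F i)
          (face-support (c (σ d)) two {F} {barycentre d} (value≤2 (σ d)) (barycentre-value d)
                        w i λᵢ≢0))

    supported-link : ∀ d {F} → InConv F (barycentre d) → ∀ p →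
      Σ Link λ l → link d l ∈ F × EndpointOf p l
    supported-link d {F} w p =
      through (coordinate-support {F = F} {barycentre d} w ⌊ p ⌋ (barycentre-nonzero d p))
      where
      through : Σ (Fin (length F)) (λ i → proj₁ w i ≢ 0ℚ ×
                  (⌊ p ⌋ ≡ head (lookup F i) ⊎ ⌊ p ⌋ ≡ tail (lookup F i))) →
                Σ Link λ l → link d l ∈ F × EndpointOf p l
      through (i , λᵢ≢0 , endpoint) =
        l , subst (_∈ F) Fᵢ≡l (∈-lookup i) ,
        Sum.map (⌊⌋-injective {p} {inj₁ (proj₁ l)}) (⌊⌋-injective {p} {inj₂ (proj₂ l)})
          (link-endpoint d l (subst (λ a → ⌊ p ⌋ ≡ head a ⊎ ⌊ p ⌋ ≡ tail a) Fᵢ≡l endpoint))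
        where
        l = proj₁ (weighted-link d {F} w i λᵢ≢0)
        Fᵢ≡l = proj₂ (weighted-link d {F} w i λᵢ≢0)

    -- The face of the triangulation containing x yields a conflicting edge.
    no-canonical-crossing : ∀ d → ¬ CrossingEdge d
    no-canonical-crossing d cross =
      face-contradiction (RepresentsTriangulation.covers tri (barycentre d) (barycentre-boundary d))
      where
      face-contradiction : Σ (List (Arrow M)) (λ F → Face E F × InConv F (barycentre d)) → ⊥
      face-contradiction (F , face , w) = absent (covering-conflict (covering (supported-link d {F} w)))
        where
        absent : Σ Link (λ l → Σ Link λ l′ → link d l ∈ F × link d l′ ∈ F × Conflict l l′) → ⊥
        absent (_ , _ , l∈F , l′∈F , conflict) =
          conflict-non-edge d cross conflict
            (face-edge flag face l∈F l′∈F (conflict-distinct d conflict))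

    -- By uniformity every crossing edge of the type would give the canonical one.
    no-crossing : ∀ d → DoesNotCross (crossType d) E
    no-crossing d a b p₁ p₂ p₃ p₄ type cross Eab
      with crossing-normal flag (crossType d) type cross Eab
    ... | α , β , typeαβ , jα , jβ , Eαβ =
      no-canonical-crossing d
        (transfer uniform (HasType-increasing (crossType d) typeαβ) canonical-increasing
                  (crossing-roles d typeαβ jα jβ) (canonical-realises d) Eαβ)

proposition3p5 : (n : ℕ) → 4 ≤ n →
    (E : Arrow (suc n) → Arrow (suc n) → Set) →
    IsFlagGraph E → Uniform E → RepresentsTriangulation E →
    DoesNotNest (T ∷ H ∷ T ∷ H ∷ []) E → DoesNotNest (H ∷ T ∷ H ∷ T ∷ []) E →
    DoesNotCross (H ∷ T ∷ T ∷ H ∷ []) E × DoesNotCross (T ∷ H ∷ H ∷ T ∷ []) E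
proposition3p5 (suc (suc (suc (suc k)))) (s≤s (s≤s (s≤s (s≤s z≤n)))) E
               flag uniform tri noTHTH noHTHT =
  no-crossing fromOdd , no-crossing fromEven
  where
  open FivePoints k
  open Argument flag uniform tri noTHTH noHTHT
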